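{- Let $(G,w)$ be a weighted game graph, $B>0$ an integer, $(\sigma,\tau)$ a pair of strategies and $v$ a node. If $e^*_{G(\sigma,\tau),w}(v)=\infty$ implies $e^*_{G(\sigma,\tau),w_B}(v)=\infty$, then $e^*_{G(\sigma,\tau),w}(v)\le e^*_{G(\sigma,\tau),w_B}(v)+nB$.
   Context: A weighted game graph $(G,w)$ consists of a finite directed graph $G=(V,E)$ in which every node has out-degree at least $1$, a partition $V=V_A\cup V_B$ into nodes of Alice and of Bob, and integer edge weights $w:E\to\mathbb{Z}$; $n=|V|$. A (positional) strategy $\sigma$ of Alice picks for each $u\in V_A$ an out-neighbor $\sigma(u)$; a strategy $\tau$ of Bob picks for each $u\in V_B$ an out-neighbor $\tau(u)$. $G(\sigma,\tau)$ is the subgraph with edges $\{(u,\sigma(u)):u\in V_A\}\cup\{(u,\tau(u)):u\in V_B\}$; from any node $s$ there is a unique cycle $C$ reachable in it. For a weight function $w'$, $w'(P)$ is the total $w'$-weight of a path/cycle $P$; $e^*_{G(\sigma,\tau),w'}(s)=\infty$ if $w'(C)<0$, else $\max\{0,-\min_P w'(P)\}$ over simple paths $P$ in $G(\sigma,\tau)$ starting at $s$. The rounded weight function is $w_B(u,v)=\lceil w(u,v)/B\rceil\cdot B$. -}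

module Defs where

open import Data.Bool using (Bool; true; false; not; T; if_then_else_; _∧_)
open import Data.Unit using (tt)
open import Data.Nat as ℕ using (ℕ; zero; suc; NonZero)
open import Data.Integer as ℤ using (ℤ; +_; -_; _⊔_; ∣_∣)
open import Data.Integer.DivMod using (_/ℕ_)
open import Data.Fin using (Fin; _≟_)
open import Data.List using (List; []; _∷_; foldr; upTo)
open import Data.Product using (Σ; ∃; proj₁)
open import Relation.Nullary.Decidable using (⌊_⌋)

-- A weighted game graph on the node set V = Fin n.
-- ownerA u = true  : u ∈ V_A (Alice),  false : u ∈ V_B (Bob).
record GameGraph (n : ℕ) : Set₁ where
  field
    Edge   : Fin n → Fin n → Set
    outdeg : ∀ u → ∃ (Edge u)
    ownerA : Fin n → Bool
    w      : Fin n → Fin n → ℤ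

module _ {n : ℕ} (G : GameGraph n) where
  open GameGraph G

  StrategyA : Set
  StrategyA = (u : Fin n) → T (ownerA u) → Σ (Fin n) (Edge u)

  StrategyB : Set
  StrategyB = (u : Fin n) → T (not (ownerA u)) → Σ (Fin n) (Edge u)

private
  choose : {X : Set} (b : Bool) → (T b → X) → (T (not b) → X) → X
  choose true  f g = f tt
  choose false f g = g tt

-- successor function of the subgraph G(σ,τ) (every node has out-degree 1)
succ : ∀ {n} (G : GameGraph n) → StrategyA G → StrategyB G → Fin n → Fin n
succ G σ τ u = proj₁ (choose (GameGraph.ownerA G u) (σ u) (τ u))

iter : ∀ {n} → (Fin n → Fin n) → ℕ → Fin n → Fin n
iter f zero    s = s
iter f (suc k) s = iter f k (f s)

walkWeight : ∀ {n} → (Fin n → Fin n) → (Fin n → Fin n → ℤ) → Fin n → ℕ → ℤ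
walkWeight f w' s zero    = + 0
walkWeight f w' s (suc k) = w' s (f s) ℤ.+ walkWeight f w' (f s) k

allL : ∀ {A : Set} → (A → Bool) → List A → Bool
allL p []       = true
allL p (x ∷ xs) = p x ∧ allL p xs

distinct : ∀ {n} → List (Fin n) → Bool
distinct []       = true
distinct (x ∷ xs) = allL (λ y → not ⌊ x ≟ y ⌋) xs ∧ distinct xs

nodesOf : ∀ {n} → (Fin n → Fin n) → Fin n → ℕ → List (Fin n)
nodesOf f s zero    = s ∷ []
nodesOf f s (suc k) = s ∷ nodesOf f (f s) k

isSimple : ∀ {n} → (Fin n → Fin n) → Fin n → ℕ → Bool
isSimple f s k = distinct (nodesOf f s k)

-- max{0, - min_P w'(P)} over simple paths P starting at s
-- (a simple path has at most n-1 edges, so k ranges over 0..n-1)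
maxDeficit : ∀ {n} → (Fin n → Fin n) → (Fin n → Fin n → ℤ) → Fin n → ℤ
maxDeficit {n} f w' s =
  foldr (λ k acc → if isSimple f s k then acc ⊔ (- walkWeight f w' s k) else acc)
        (+ 0) (upTo n)

-- The unique cycle C reachable from s: c = f^n s lies on C, and the length of C
-- is the least p ∈ {1,…,n} with f^p c = c.
firstReturn : ∀ {n} → (Fin n → Fin n) → Fin n → List ℕ → ℕ
firstReturn f c []       = 0
firstReturn f c (p ∷ ps) = if ⌊ iter f p c ≟ c ⌋ then p else firstReturn f c ps

cycleNode : ∀ {n} → (Fin n → Fin n) → Fin n → Fin n
cycleNode {n} f s = iter f n s

cycleLength : ∀ {n} → (Fin n → Fin n) → Fin n → ℕ
cycleLength {n} f s = firstReturn f (cycleNode f s) (Data.List.map suc (upTo n))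

cycleWeight : ∀ {n} → (Fin n → Fin n) → (Fin n → Fin n → ℤ) → Fin n → ℤ
cycleWeight f w' s = walkWeight f w' (cycleNode f s) (cycleLength f s)

data ℕ∞ : Set where
  fin : ℕ → ℕ∞
  ∞   : ℕ∞

_+∞_ : ℕ∞ → ℕ → ℕ∞
fin a +∞ b = fin (a ℕ.+ b)
∞     +∞ b = ∞

data _≤∞_ : ℕ∞ → ℕ∞ → Set where
  fin≤fin : ∀ {a b} → a ℕ.≤ b → fin a ≤∞ fin b
  _≤∞∞    : ∀ x → x ≤∞ ∞

eStar : ∀ {n} (G : GameGraph n) → StrategyA G → StrategyB G →
        (Fin n → Fin n → ℤ) → Fin n → ℕ∞
eStar G σ τ w' s =
  if ⌊ cycleWeight f w' s ℤ.<? + 0 ⌋ then ∞ else fin ∣ maxDeficit f w' s ∣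
  where f = succ G σ τ

-- ⌈a / B⌉ for B > 0 (floor division /ℕ is Euclidean, i.e. floor for B > 0)
ceilDiv : ℤ → (B : ℕ) → .{{NonZero B}} → ℤ
ceilDiv a B = - ((- a) /ℕ B)

roundW : ∀ {n} → (Fin n → Fin n → ℤ) → (B : ℕ) → .{{NonZero B}} → Fin n → Fin n → ℤ
roundW w B u v = ceilDiv (w u v) B ℤ.* + B

module Submission where

open import Defs
open import Data.Nat using (ℕ; NonZero; _*_)
open import Data.Fin using (Fin)
open import Relation.Binary.PropositionalEquality using (_≡_)

open import Data.Bool using (Bool; true; false; if_then_else_)
open import Data.Nat as ℕ using ()
import Data.Nat.Properties as ℕ
open import Data.Integer as ℤ using (ℤ; +_; -_; _+_; _≤_; _⊔_; ∣_∣; 0ℤ; 1ℤ; +≤+)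
open import Data.Integer.Properties
open import Data.Integer.DivMod using (_/ℕ_; n<s[n/ℕd]*d)
open import Data.Integer.Tactic.RingSolver using (solve-∀)
open import Data.List using (List; []; _∷_; foldr; upTo)
open import Data.List.Relation.Unary.All using (All; []; _∷_; map)
open import Data.List.Relation.Unary.All.Properties using (all-upTo)
open import Relation.Binary.PropositionalEquality using (refl; cong)
open import Relation.Nullary.Decidable using (⌊_⌋)

-- Rounding every edge weight up to a multiple of B raises a walk with k edges
-- by at most k·B; a simple path has fewer than n edges, so every deficit
-- -w(P) drops by at most n·B under w_B.  When the w-cycle is negative so is
-- the w_B-cycle by hypothesis, and when only the w_B-cycle is negative the
-- right-hand side is ∞.

ceilDiv*B≤a+B : ∀ (a : ℤ) (B : ℕ) .{{_ : NonZero B}} → ceilDiv a B ℤ.* + B ≤ a + + B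
ceilDiv*B≤a+B a B = begin
  - q ℤ.* + B                  ≡⟨ shift q (+ B) ⟩
  - ((1ℤ + q) ℤ.* + B) + + B   ≤⟨ +-monoˡ-≤ (+ B) (neg-mono-≤ (<⇒≤ (n<s[n/ℕd]*d (- a) B))) ⟩
  - - a + + B                  ≡⟨ cong (_+ + B) (neg-involutive a) ⟩
  a + + B                      ∎
  where
  open ≤-Reasoning
  q = (- a) /ℕ B
  shift : ∀ x y → - x ℤ.* y ≡ - ((1ℤ + x) ℤ.* y) + y
  shift = solve-∀

i≤j+k⇒-j≤-i+k : ∀ {i j k : ℤ} → i ≤ j + k → - j ≤ - i + k
i≤j+k⇒-j≤-i+k {i} {j} {k} i≤j+k = begin
  - j            ≡⟨ shift j k ⟩
  - (j + k) + k  ≤⟨ +-monoˡ-≤ k (neg-mono-≤ i≤j+k) ⟩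
  - i + k        ∎
  where
  open ≤-Reasoning
  shift : ∀ x y → - x ≡ - (x + y) + y
  shift = solve-∀

∣i∣≤∣j∣+m : ∀ {i j : ℤ} {m : ℕ} → 0ℤ ≤ i → 0ℤ ≤ j → i ≤ j + + m → ∣ i ∣ ℕ.≤ ∣ j ∣ ℕ.+ m
∣i∣≤∣j∣+m (+≤+ _) (+≤+ _) i≤j+m = drop‿+≤+ i≤j+m

module _ {n : ℕ} (f : Fin n → Fin n) where

  walkWeight-≤-+ : ∀ (w w′ : Fin n → Fin n → ℤ) (c : ℕ) →
                   (∀ u v → w′ u v ≤ w u v + + c) →
                   ∀ s k → walkWeight f w′ s k ≤ walkWeight f w s k + + (k * c)
  walkWeight-≤-+ w w′ c w′≤w+c s ℕ.zero    = ≤-refl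
  walkWeight-≤-+ w w′ c w′≤w+c s (ℕ.suc k) = begin
    w′ s (f s) + walkWeight f w′ (f s) k
      ≤⟨ +-mono-≤ (w′≤w+c s (f s)) (walkWeight-≤-+ w w′ c w′≤w+c (f s) k) ⟩
    (w s (f s) + + c) + (walkWeight f w (f s) k + + (k * c))
      ≡⟨ interchange (w s (f s)) (+ c) (walkWeight f w (f s) k) (+ (k * c)) ⟩
    (w s (f s) + walkWeight f w (f s) k) + (+ c + + (k * c))
      ≡⟨ cong (_+_ (w s (f s) + walkWeight f w (f s) k)) (pos-+ c (k * c)) ⟨
    (w s (f s) + walkWeight f w (f s) k) + + (c ℕ.+ k * c)
      ∎
    where
    open ≤-Reasoning
    interchange : ∀ a b x y → (a + b) + (x + y) ≡ (a + x) + (b + y)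
    interchange = solve-∀

  module _ (s : Fin n) where

    private
      deficitOver : (Fin n → Fin n → ℤ) → List ℕ → ℤ
      deficitOver w = foldr (λ k acc → if isSimple f s k then acc ⊔ (- walkWeight f w s k) else acc) (+ 0)

      deficitOver-nonNeg : ∀ w ks → 0ℤ ≤ deficitOver w ks
      deficitOver-nonNeg w []       = ≤-refl
      deficitOver-nonNeg w (k ∷ ks) with isSimple f s k
      ... | true  = ≤-trans (deficitOver-nonNeg w ks) (i≤i⊔j _ _)
      ... | false = deficitOver-nonNeg w ks

      deficitOver-≤-+ : ∀ (w w′ : Fin n → Fin n → ℤ) (d : ℕ) ks →
                        All (λ k → - walkWeight f w s k ≤ - walkWeight f w′ s k + + d) ks →
                        deficitOver w ks ≤ deficitOver w′ ks + + d
      deficitOver-≤-+ w w′ d []       []         = +≤+ ℕ.z≤n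
      deficitOver-≤-+ w w′ d (k ∷ ks) (hk ∷ hks) with isSimple f s k
      ... | false = deficitOver-≤-+ w w′ d ks hks
      ... | true  = ⊔-lub
        (≤-trans (deficitOver-≤-+ w w′ d ks hks) (+-monoˡ-≤ (+ d) (i≤i⊔j (deficitOver w′ ks) (- walkWeight f w′ s k))))
        (≤-trans hk (+-monoˡ-≤ (+ d) (i≤j⊔i (deficitOver w′ ks) (- walkWeight f w′ s k))))

    maxDeficit-nonNeg : ∀ w → 0ℤ ≤ maxDeficit f w s
    maxDeficit-nonNeg w = deficitOver-nonNeg w (upTo n)

    maxDeficit-≤-+ : ∀ (w w′ : Fin n → Fin n → ℤ) (d : ℕ) →
                     (∀ k → k ℕ.< n → - walkWeight f w s k ≤ - walkWeight f w′ s k + + d) →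
                     maxDeficit f w s ≤ maxDeficit f w′ s + + d
    maxDeficit-≤-+ w w′ d bound =
      deficitOver-≤-+ w w′ d (upTo n) (map (bound _) (all-upTo n))

    ∣maxDeficit∣-roundW : ∀ (w : Fin n → Fin n → ℤ) (B : ℕ) .{{_ : NonZero B}} →
                          ∣ maxDeficit f w s ∣ ℕ.≤ ∣ maxDeficit f (roundW w B) s ∣ ℕ.+ n * B
    ∣maxDeficit∣-roundW w B = ∣i∣≤∣j∣+m (maxDeficit-nonNeg w) (maxDeficit-nonNeg (roundW w B))
      (maxDeficit-≤-+ w (roundW w B) (n * B) simpleBound)
      where
      simpleBound : ∀ k → k ℕ.< n → - walkWeight f w s k ≤ - walkWeight f (roundW w B) s k + + (n * B)
      simpleBound k k<n = i≤j+k⇒-j≤-i+k (≤-trans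
        (walkWeight-≤-+ w (roundW w B) B (λ u v → ceilDiv*B≤a+B (w u v) B) s k)
        (+-monoʳ-≤ (walkWeight f w s k) (+≤+ (ℕ.*-monoˡ-≤ B (ℕ.<⇒≤ k<n)))))

fin-or-∞-≤∞ : ∀ (b b′ : Bool) {x y d : ℕ} →
              ((if b then ∞ else fin x) ≡ ∞ → (if b′ then ∞ else fin y) ≡ ∞) →
              x ℕ.≤ y ℕ.+ d →
              (if b then ∞ else fin x) ≤∞ ((if b′ then ∞ else fin y) +∞ d)
fin-or-∞-≤∞ true  true  _ _ = ∞ ≤∞∞
fin-or-∞-≤∞ true  false ∞⇒∞ _ with ∞⇒∞ refl
... | ()
fin-or-∞-≤∞ false true  _ _ = _ ≤∞∞
fin-or-∞-≤∞ false false _ x≤y+d = fin≤fin x≤y+d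

lemma10 : ∀ {n} (G : GameGraph n) (B : ℕ) .{{_ : NonZero B}}
            (σ : StrategyA G) (τ : StrategyB G) (v : Fin n) →
            (eStar G σ τ (GameGraph.w G) v ≡ ∞ → eStar G σ τ (roundW (GameGraph.w G) B) v ≡ ∞) →
            eStar G σ τ (GameGraph.w G) v ≤∞ (eStar G σ τ (roundW (GameGraph.w G) B) v +∞ (n * B))
lemma10 G B σ τ v ∞⇒∞ =
  fin-or-∞-≤∞ (⌊ cycleWeight f w v ℤ.<? + 0 ⌋) (⌊ cycleWeight f (roundW w B) v ℤ.<? + 0 ⌋)
    ∞⇒∞ (∣maxDeficit∣-roundW f v w B)
  where
  f = succ G σ τ
  w = GameGraph.w G
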